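{- Let $t$ be a positive integer with $t\equiv -1 \pmod{96}$ or $t\equiv 1\pmod{96}$. Then $\chi_{\rho}(G(\mathbb{Z},\{1,t\}))\leq 29$.
   Context: For a graph $G$, a packing $k$-coloring is a map $f:V(G)\to\{1,\ldots,k\}$ such that any two distinct vertices $u,v$ with $f(u)=f(v)=i$ satisfy $d_G(u,v)\geq i+1$. The packing chromatic number $\chi_{\rho}(G)$ is the least $k$ for which a packing $k$-coloring exists. $G(\mathbb{Z},D)$ is the graph on $\mathbb{Z}$ with $i,j$ adjacent iff $|i-j|\in D$. -}

module Defs where

open import Data.Nat using (ℕ; zero; suc; _≤_)
open import Data.Integer using (ℤ; +_; _-_; ∣_∣)
open import Data.Fin using (Fin; toℕ)
open import Data.List using (List)
open import Data.List.Membership.Propositional using (_∈_)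
open import Relation.Binary.PropositionalEquality using (_≡_)
open import Relation.Nullary using (¬_)
open import Data.Product using (∃)

Adj : List ℕ → ℤ → ℤ → Set
Adj D i j = ∣ i - j ∣ ∈ D

data Walk (D : List ℕ) : ℤ → ℤ → ℕ → Set where
  here : ∀ {u} → Walk D u u zero
  step : ∀ {u w v n} → Adj D u w → Walk D w v n → Walk D u v (suc n)

DistAtLeast : List ℕ → ℤ → ℤ → ℕ → Set
DistAtLeast D u v m = ∀ n → suc n ≤ m → ¬ Walk D u v n

-- Packing k-coloring of G(ℤ,D); colour c : Fin k stands for colour toℕ c + 1 ∈ {1..k}.
-- Two distinct vertices of colour i must be at distance ≥ i + 1.
IsPackingColoring : (D : List ℕ) (k : ℕ) → (ℤ → Fin k) → Set
IsPackingColoring D k f =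
  ∀ u v → ¬ (u ≡ v) → f u ≡ f v → DistAtLeast D u v (suc (suc (toℕ (f u))))

PackingChromatic≤ : List ℕ → ℕ → Set
PackingChromatic≤ D k = ∃ λ (f : ℤ → Fin k) → IsPackingColoring D k f

module Submission where

open import Defs
open import Data.Nat using (ℕ; suc; _+_; _*_; _≤_)
open import Data.List using (_∷_; [])
open import Data.Product using (∃)
open import Data.Sum using (_⊎_)
open import Relation.Binary.PropositionalEquality using (_≡_)

open import Data.Bool using (Bool; true; _∧_)
open import Data.Bool.Properties using (T-≡; ∧-conicalˡ; ∧-conicalʳ)
open import Data.Fin using (Fin; toℕ; #_)
import Data.Fin.Properties as FinP
open import Data.Integer as ℤ using (ℤ; +_; -[1+_]; 0ℤ; ∣_∣; _%ℕ_; _/ℕ_)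
open import Data.Integer.DivMod using (a≡a%ℕn+[a/ℕn]*n; n%ℕd<d)
import Data.Integer.Properties as ℤP
open import Data.Integer.Tactic.RingSolver using (solve-∀)
open import Data.List.Relation.Unary.Any using (here; there)
open import Data.Nat as ℕ using (zero; NonZero)
open import Data.Nat.DivMod using (_mod_; m≡m%n+[m/n]*n; m%n≤m; m<n*o⇒m/o<n)
import Data.Nat.Properties as ℕP
open import Data.Product using (_×_; _,_; proj₁; proj₂; ∃₂)
open import Data.Sum using (inj₁; inj₂)
open import Data.Vec using (Vec; _∷_; []; lookup; replicate)
open import Function.Bundles using (Equivalence)
open import Relation.Binary.Definitions using (tri<; tri≈; tri>)
open import Relation.Binary.PropositionalEquality
  using (_≢_; refl; sym; trans; cong; cong₂; subst; subst₂; module ≡-Reasoning)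
open import Relation.Nullary using (¬_; Dec; yes; no; ¬?; contradiction)
open import Relation.Nullary.Decidable using (isYes; map′; toWitness; _×-dec_; _→-dec_)
open import Relation.Unary using (Decidable)
open import Algebra.Properties.AbelianGroup ℤP.+-0-abelianGroup using (∙-cancelʳ)
open import Algebra.Properties.CommutativeSemigroup ℕP.+-commutativeSemigroup using (interchange)

-- For t = 1 the graph is the path on ℤ, coloured 1,2,1,3 periodically.  Otherwise
-- t = N + σ with N = 96k (k ≥ 1) and σ = ±1, and u ∈ ℤ receives the colour
--   tab_σ[u mod 96][⌊u/N⌋ mod 16]
-- from an explicit 96 × 16 table.  If u has colour c+1, the vertices within
-- distance c+1 of u are u + a + b·t with |a| + |b| ≤ c+1, that is u + e + b·N with
-- e = a + σb and |e| ≤ 29 < 96.  Such a move shifts the row u mod 96 by e and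
-- the column ⌊u/N⌋ by b + κ, where the carry κ ∈ {-1,0,1} can only be nonzero if
-- the row leaves [0,96) in the same direction, whatever k is.  So one finite
-- verification per table, carried out by evaluation, covers all t = 96k ± 1.

module Division (d : ℕ) .{{_ : NonZero d}} where

  no-larger-quotient : ∀ {r r' q q'} → r ℤ.< + d → 0ℤ ℤ.≤ r' → q ℤ.< q' →
                       r ℤ.+ q ℤ.* + d ≢ r' ℤ.+ q' ℤ.* + d
  no-larger-quotient {r} {r'} {q} {q'} r<d 0≤r' q<q' eq = ℤP.<-irrefl eq (begin-strict
      r ℤ.+ q ℤ.* + d          <⟨ ℤP.+-monoˡ-< (q ℤ.* + d) r<d ⟩
      + d ℤ.+ q ℤ.* + d        ≡⟨ ℤP.suc-* q (+ d) ⟨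
      ℤ.suc q ℤ.* + d          ≤⟨ ℤP.*-monoʳ-≤-nonNeg (+ d) (ℤP.i<j⇒suc[i]≤j q<q') ⟩
      q' ℤ.* + d               ≡⟨ ℤP.+-identityˡ (q' ℤ.* + d) ⟨
      0ℤ ℤ.+ q' ℤ.* + d        ≤⟨ ℤP.+-monoˡ-≤ (q' ℤ.* + d) 0≤r' ⟩
      r' ℤ.+ q' ℤ.* + d        ∎)
    where open ℤP.≤-Reasoning

  quotient-unique : ∀ {r r' q q'} → 0ℤ ℤ.≤ r → r ℤ.< + d → 0ℤ ℤ.≤ r' → r' ℤ.< + d →
                    r ℤ.+ q ℤ.* + d ≡ r' ℤ.+ q' ℤ.* + d → q ≡ q'
  quotient-unique {q = q} {q'} 0≤r r<d 0≤r' r'<d eq with ℤP.<-cmp q q'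
  ... | tri< q<q' _ _ = contradiction eq (no-larger-quotient r<d 0≤r' q<q')
  ... | tri≈ _ q≡q' _ = q≡q'
  ... | tri> _ _ q'<q = contradiction (sym eq) (no-larger-quotient r'<d 0≤r q'<q)


  /ℕ-char : ∀ {x r q} → 0ℤ ℤ.≤ r → r ℤ.< + d → x ≡ r ℤ.+ q ℤ.* + d → x /ℕ d ≡ q
  /ℕ-char {x} 0≤r r<d x≡r+qd = quotient-unique (ℤ.+≤+ ℕ.z≤n) (ℤ.+<+ (n%ℕd<d x d)) 0≤r r<d
    (trans (sym (a≡a%ℕn+[a/ℕn]*n x d)) x≡r+qd)

  shifted-representation : ∀ x k → x ℤ.+ k ℤ.* + d ≡ + (x %ℕ d) ℤ.+ (x /ℕ d ℤ.+ k) ℤ.* + d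
  shifted-representation x k = begin
      x ℤ.+ k ℤ.* + d                                  ≡⟨ cong (ℤ._+ k ℤ.* + d) (a≡a%ℕn+[a/ℕn]*n x d) ⟩
      + (x %ℕ d) ℤ.+ (x /ℕ d) ℤ.* + d ℤ.+ k ℤ.* + d   ≡⟨ regroup (+ (x %ℕ d)) (x /ℕ d) k (+ d) ⟩
      + (x %ℕ d) ℤ.+ (x /ℕ d ℤ.+ k) ℤ.* + d           ∎
    where
    open ≡-Reasoning
    regroup : ∀ r q k d → r ℤ.+ q ℤ.* d ℤ.+ k ℤ.* d ≡ r ℤ.+ (q ℤ.+ k) ℤ.* d
    regroup = solve-∀

  /ℕ-shift : ∀ x k → (x ℤ.+ k ℤ.* + d) /ℕ d ≡ x /ℕ d ℤ.+ k
  /ℕ-shift x k = /ℕ-char (ℤ.+≤+ ℕ.z≤n) (ℤ.+<+ (n%ℕd<d x d)) (shifted-representation x k)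

  %ℕ-shift : ∀ x k → (x ℤ.+ k ℤ.* + d) %ℕ d ≡ x %ℕ d
  %ℕ-shift x k = ℤP.+-injective (∙-cancelʳ ((x /ℕ d ℤ.+ k) ℤ.* + d) _ _ (begin
      + (y %ℕ d) ℤ.+ (x /ℕ d ℤ.+ k) ℤ.* + d   ≡⟨ cong (λ q → + (y %ℕ d) ℤ.+ q ℤ.* + d) (/ℕ-shift x k) ⟨
      + (y %ℕ d) ℤ.+ (y /ℕ d) ℤ.* + d         ≡⟨ a≡a%ℕn+[a/ℕn]*n y d ⟨
      y                                       ≡⟨ shifted-representation x k ⟩
      + (x %ℕ d) ℤ.+ (x /ℕ d ℤ.+ k) ℤ.* + d   ∎))
    where
    open ≡-Reasoning
    y : ℤ
    y = x ℤ.+ k ℤ.* + d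

  %ℕ-+ : ∀ x z → (x ℤ.+ z) %ℕ d ≡ (+ (x %ℕ d) ℤ.+ z) %ℕ d
  %ℕ-+ x z = begin
      (x ℤ.+ z) %ℕ d                                         ≡⟨ cong (λ w → (w ℤ.+ z) %ℕ d) (a≡a%ℕn+[a/ℕn]*n x d) ⟩
      (+ (x %ℕ d) ℤ.+ (x /ℕ d) ℤ.* + d ℤ.+ z) %ℕ d          ≡⟨ cong (_%ℕ d) (swap (+ (x %ℕ d)) (x /ℕ d ℤ.* + d) z) ⟩
      (+ (x %ℕ d) ℤ.+ z ℤ.+ (x /ℕ d) ℤ.* + d) %ℕ d          ≡⟨ %ℕ-shift (+ (x %ℕ d) ℤ.+ z) (x /ℕ d) ⟩
      (+ (x %ℕ d) ℤ.+ z) %ℕ d                                ∎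
    where
    open ≡-Reasoning
    swap : ∀ a b c → a ℤ.+ b ℤ.+ c ≡ a ℤ.+ c ℤ.+ b
    swap = solve-∀

module Walks (d₁ d₂ : ℕ) where

  displace : ℤ → ℤ → ℤ → ℤ
  displace u a b = u ℤ.+ (a ℤ.* + d₁ ℤ.+ b ℤ.* + d₂)

  displace-displace : ∀ u a b a' b' → displace (displace u a b) a' b' ≡ displace u (a ℤ.+ a') (b ℤ.+ b')
  displace-displace u a b a' b' = regroup u a b a' b' (+ d₁) (+ d₂)
    where
    regroup : ∀ u a b a' b' d₁ d₂ →
      u ℤ.+ (a ℤ.* d₁ ℤ.+ b ℤ.* d₂) ℤ.+ (a' ℤ.* d₁ ℤ.+ b' ℤ.* d₂) ≡ u ℤ.+ ((a ℤ.+ a') ℤ.* d₁ ℤ.+ (b ℤ.+ b') ℤ.* d₂)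
    regroup = solve-∀

  Reach : ℤ → ℤ → ℕ → Set
  Reach u v n = ∃₂ λ a b → v ≡ displace u a b × ∣ a ∣ + ∣ b ∣ ≤ n

  unit-step : ∀ {u w d} → ∣ u ℤ.- w ∣ ≡ d → ∃ λ ε → w ≡ u ℤ.+ ε ℤ.* + d × ∣ ε ∣ ≤ 1
  unit-step {u} {w} {d} ∣u-w∣≡d with ℤP.+∣i∣≡i⊎+∣i∣≡-i (u ℤ.- w)
  ... | inj₁ e = ℤ.-1ℤ , (begin
      w                       ≡⟨ back-and-forth u w ⟩
      u ℤ.- (u ℤ.- w)         ≡⟨ cong (λ x → u ℤ.- x) (trans (sym e) (cong +_ ∣u-w∣≡d)) ⟩
      u ℤ.- + d               ≡⟨ minus (+ d) u ⟩
      u ℤ.+ ℤ.-1ℤ ℤ.* + d     ∎) , ℕP.≤-refl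
    where
    open ≡-Reasoning
    back-and-forth : ∀ u w → w ≡ u ℤ.- (u ℤ.- w)
    back-and-forth = solve-∀
    minus : ∀ d u → u ℤ.- d ≡ u ℤ.+ ℤ.-1ℤ ℤ.* d
    minus = solve-∀
  ... | inj₂ e = ℤ.1ℤ , (begin
      w                       ≡⟨ back-and-forth u w ⟩
      u ℤ.+ ℤ.- (u ℤ.- w)     ≡⟨ cong (λ x → u ℤ.+ x) (trans (sym e) (cong +_ ∣u-w∣≡d)) ⟩
      u ℤ.+ + d               ≡⟨ plus (+ d) u ⟩
      u ℤ.+ ℤ.1ℤ ℤ.* + d      ∎) , ℕP.≤-refl
    where
    open ≡-Reasoning
    back-and-forth : ∀ u w → w ≡ u ℤ.+ ℤ.- (u ℤ.- w)
    back-and-forth = solve-∀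
    plus : ∀ d u → u ℤ.+ d ≡ u ℤ.+ ℤ.1ℤ ℤ.* d
    plus = solve-∀

  edge-reach : ∀ {u w} → Adj (d₁ ∷ d₂ ∷ []) u w → Reach u w 1
  edge-reach {u} {w} (here ∣u-w∣≡d₁) with unit-step {u} {w} ∣u-w∣≡d₁
  ... | ε , w≡ , ∣ε∣≤1 = ε , 0ℤ , trans w≡ (only-first u ε (+ d₁) (+ d₂)) , ℕP.≤-trans (ℕP.≤-reflexive (ℕP.+-identityʳ ∣ ε ∣)) ∣ε∣≤1
    where
    only-first : ∀ u ε d₁ d₂ → u ℤ.+ ε ℤ.* d₁ ≡ u ℤ.+ (ε ℤ.* d₁ ℤ.+ 0ℤ ℤ.* d₂)
    only-first = solve-∀
  edge-reach {u} {w} (there (here ∣u-w∣≡d₂)) with unit-step {u} {w} ∣u-w∣≡d₂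
  ... | ε , w≡ , ∣ε∣≤1 = 0ℤ , ε , trans w≡ (only-second u ε (+ d₁) (+ d₂)) , ∣ε∣≤1
    where
    only-second : ∀ u ε d₁ d₂ → u ℤ.+ ε ℤ.* d₂ ≡ u ℤ.+ (0ℤ ℤ.* d₁ ℤ.+ ε ℤ.* d₂)
    only-second = solve-∀

  walk-reach : ∀ {u v n} → Walk (d₁ ∷ d₂ ∷ []) u v n → Reach u v n
  walk-reach {u} here = 0ℤ , 0ℤ , stay u (+ d₁) (+ d₂) , ℕP.≤-refl
    where
    stay : ∀ u d₁ d₂ → u ≡ u ℤ.+ (0ℤ ℤ.* d₁ ℤ.+ 0ℤ ℤ.* d₂)
    stay = solve-∀
  walk-reach {u} {v} (step {w = w} adj walk) with edge-reach {u} {w} adj | walk-reach {w} {v} walk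
  ... | a , b , refl , ab≤1 | a' , b' , refl , a'b'≤n =
    a ℤ.+ a' , b ℤ.+ b' , displace-displace u a b a' b' , (begin
      ∣ a ℤ.+ a' ∣ + ∣ b ℤ.+ b' ∣              ≤⟨ ℕP.+-mono-≤ (ℤP.∣i+j∣≤∣i∣+∣j∣ a a') (ℤP.∣i+j∣≤∣i∣+∣j∣ b b') ⟩
      (∣ a ∣ + ∣ a' ∣) + (∣ b ∣ + ∣ b' ∣)      ≡⟨ interchange (∣ a ∣) (∣ a' ∣) (∣ b ∣) (∣ b' ∣) ⟩
      (∣ a ∣ + ∣ b ∣) + (∣ a' ∣ + ∣ b' ∣)      ≤⟨ ℕP.+-monoˡ-≤ (∣ a' ∣ + ∣ b' ∣) ab≤1 ⟩
      1 + (∣ a' ∣ + ∣ b' ∣)                    ≤⟨ ℕP.+-monoʳ-≤ 1 a'b'≤n ⟩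
      suc _                                    ∎)
    where open ℕP.≤-Reasoning

  packing-criterion : ∀ {k} (f : ℤ → Fin k) →
    (∀ u a b → ∣ a ∣ + ∣ b ∣ ≤ suc (toℕ (f u)) → displace u a b ≢ u → f (displace u a b) ≢ f u) →
    IsPackingColoring (d₁ ∷ d₂ ∷ []) k f
  packing-criterion f separated u v u≢v fu≡fv n n<c+2 walk with walk-reach walk
  ... | a , b , refl , ab≤n = separated u a b (ℕP.≤-trans ab≤n (ℕ.s≤s⁻¹ n<c+2)) (λ v≡u → u≢v (sym v≡u)) (sym fu≡fv)

abs-bounds : ∀ {e m} → ∣ e ∣ ≤ m → ℤ.- + m ℤ.≤ e × e ℤ.≤ + m
abs-bounds {+ j}                 j≤m = ℤP.neg-≤-pos , ℤ.+≤+ j≤m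
abs-bounds { -[1+ j ]} {suc m}   j<m = ℤ.-≤- (ℕ.s≤s⁻¹ j<m) , ℤ.-≤+

+-cancelʳ-≤ : ∀ a b c → a ℤ.+ c ℤ.≤ b ℤ.+ c → a ℤ.≤ b
+-cancelʳ-≤ a b c a+c≤b+c = subst₂ ℤ._≤_ (cancel a c) (cancel b c) (ℤP.+-monoˡ-≤ (ℤ.- c) a+c≤b+c)
  where
  cancel : ∀ a c → a ℤ.+ c ℤ.- c ≡ a
  cancel = solve-∀

-- Carry m ρ e κ: adding e to a digit ρ ∈ [0,m) may carry κ into the next
-- digit only if ρ + e leaves [0,m), upwards (κ = 1) or downwards (κ = -1).
data Carry (m ρ : ℕ) (e : ℤ) : ℤ → Set where
  no-carry   : Carry m ρ e 0ℤ
  carry-up   : + m ℤ.≤ + ρ ℤ.+ e → Carry m ρ e ℤ.1ℤ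
  carry-down : + ρ ℤ.+ e ℤ.< 0ℤ → Carry m ρ e ℤ.-1ℤ

module TwoScale (m n : ℕ) .{{_ : NonZero m}} .{{_ : NonZero n}} where

  N : ℕ
  N = n * m

  instance
    N-nonZero : NonZero N
    N-nonZero = ℕP.m*n≢0 n m

  open Division m using (%ℕ-shift)
  open Division N using (/ℕ-char)

  -- Since m ∣ N, the fine digit of u equals that of its residue mod N.
  fine-of-residue : ∀ u → u %ℕ m ≡ (u %ℕ N) ℕ.% m
  fine-of-residue u = begin
      u %ℕ m                                      ≡⟨ cong (_%ℕ m) (a≡a%ℕn+[a/ℕn]*n u N) ⟩
      (+ (u %ℕ N) ℤ.+ u /ℕ N ℤ.* + N) %ℕ m        ≡⟨ cong (λ z → (+ (u %ℕ N) ℤ.+ z) %ℕ m) N-multiple ⟩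
      (+ (u %ℕ N) ℤ.+ (u /ℕ N ℤ.* + n) ℤ.* + m) %ℕ m   ≡⟨ %ℕ-shift (+ (u %ℕ N)) (u /ℕ N ℤ.* + n) ⟩
      (u %ℕ N) ℕ.% m                              ∎
    where
    open ≡-Reasoning
    reassoc : ∀ y n m → y ℤ.* (n ℤ.* m) ≡ (y ℤ.* n) ℤ.* m
    reassoc = solve-∀
    N-multiple : u /ℕ N ℤ.* + N ≡ (u /ℕ N ℤ.* + n) ℤ.* + m
    N-multiple = trans (cong (u /ℕ N ℤ.*_) (ℤP.pos-* n m)) (reassoc (u /ℕ N) (+ n) (+ m))

  -- A residue s < N lies in one of the n blocks [jm, (j+1)m) of [0,N), so the end
  -- of its block, s - (s mod m) + m, is at most N.
  block-end : ∀ {s} → s ℕ.< N → s + m ≤ s ℕ.% m + N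
  block-end {s} s<N = begin
      s + m                                  ≡⟨ cong (_+ m) (m≡m%n+[m/n]*n s m) ⟩
      s ℕ.% m + s ℕ./ m * m + m              ≡⟨ ℕP.+-assoc (s ℕ.% m) _ m ⟩
      s ℕ.% m + (s ℕ./ m * m + m)            ≡⟨ cong (λ x → s ℕ.% m + x) (ℕP.+-comm (s ℕ./ m * m) m) ⟩
      s ℕ.% m + suc (s ℕ./ m) * m            ≤⟨ ℕP.+-monoʳ-≤ (s ℕ.% m) (ℕP.*-monoˡ-≤ m (m<n*o⇒m/o<n {s} {n} {m} s<N)) ⟩
      s ℕ.% m + N                            ∎
    where open ℕP.≤-Reasoning

  module Adding (u e : ℤ) (∣e∣≤m : ∣ e ∣ ≤ m) where

    s : ℕ
    s = u %ℕ N

    x : ℤ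
    x = + s ℤ.+ e

    Result : Set
    Result = ∃ λ κ → Carry m (u %ℕ m) e κ × (u ℤ.+ e) /ℕ N ≡ u /ℕ N ℤ.+ κ

    e-bounds : ℤ.- + m ℤ.≤ e × e ℤ.≤ + m
    e-bounds = abs-bounds {e} ∣e∣≤m

    m≤N : + m ℤ.≤ + N
    m≤N = ℤ.+≤+ (ℕP.m≤n*m m n)

    quotient : ∀ κ r → x ≡ r ℤ.+ κ ℤ.* + N → 0ℤ ℤ.≤ r → r ℤ.< + N → (u ℤ.+ e) /ℕ N ≡ u /ℕ N ℤ.+ κ
    quotient κ r x≡r+κN 0≤r r<N = /ℕ-char 0≤r r<N (begin
        u ℤ.+ e                               ≡⟨ cong (ℤ._+ e) (a≡a%ℕn+[a/ℕn]*n u N) ⟩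
        + s ℤ.+ u /ℕ N ℤ.* + N ℤ.+ e          ≡⟨ regroup (+ s) (u /ℕ N) e (+ N) ⟩
        x ℤ.+ u /ℕ N ℤ.* + N                  ≡⟨ cong (ℤ._+ u /ℕ N ℤ.* + N) x≡r+κN ⟩
        r ℤ.+ κ ℤ.* + N ℤ.+ u /ℕ N ℤ.* + N    ≡⟨ collect r κ (u /ℕ N) (+ N) ⟩
        r ℤ.+ (u /ℕ N ℤ.+ κ) ℤ.* + N          ∎)
      where
      open ≡-Reasoning
      regroup : ∀ s y e N → s ℤ.+ y ℤ.* N ℤ.+ e ≡ s ℤ.+ e ℤ.+ y ℤ.* N
      regroup = solve-∀
      collect : ∀ r κ y N → r ℤ.+ κ ℤ.* N ℤ.+ y ℤ.* N ≡ r ℤ.+ (y ℤ.+ κ) ℤ.* N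
      collect = solve-∀

    -- x < 0: borrow from the coarse quotient; then also the fine digit underflows,
    -- because the fine digit is at most s.
    underflow : x ℤ.< 0ℤ → Result
    underflow x<0 = ℤ.-1ℤ , carry-down (ℤP.≤-<-trans (ℤP.+-monoˡ-≤ e ρ≤s) x<0) ,
                    quotient ℤ.-1ℤ (x ℤ.+ + N) (add-back x (+ N)) x+N≥0 (ℤP.+-monoˡ-< (+ N) x<0)
      where
      open ℤP.≤-Reasoning
      ρ≤s : + (u %ℕ m) ℤ.≤ + s
      ρ≤s = ℤ.+≤+ (subst₂ _≤_ (sym (fine-of-residue u)) refl (m%n≤m s m))
      add-back : ∀ x N → x ≡ x ℤ.+ N ℤ.+ ℤ.-1ℤ ℤ.* N
      add-back = solve-∀
      x+N≥0 : 0ℤ ℤ.≤ x ℤ.+ + N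
      x+N≥0 = begin
        0ℤ                      ≤⟨ ℤP.i≤j⇒0≤j-i m≤N ⟩
        + N ℤ.- + m             ≡⟨ ℤP.+-comm (+ N) (ℤ.- + m) ⟩
        ℤ.- + m ℤ.+ + N         ≤⟨ ℤP.+-monoˡ-≤ (+ N) (proj₁ e-bounds) ⟩
        e ℤ.+ + N               ≡⟨ cong (ℤ._+ + N) (ℤP.+-identityˡ e) ⟨
        0ℤ ℤ.+ e ℤ.+ + N        ≤⟨ ℤP.+-monoˡ-≤ (+ N) (ℤP.+-monoˡ-≤ e (ℤ.+≤+ ℕ.z≤n)) ⟩
        x ℤ.+ + N               ∎

    in-range : 0ℤ ℤ.≤ x → x ℤ.< + N → Result
    in-range 0≤x x<N = 0ℤ , no-carry , quotient 0ℤ x (no-change x (+ N)) 0≤x x<N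
      where
      no-change : ∀ x N → x ≡ x ℤ.+ 0ℤ ℤ.* N
      no-change = solve-∀

    -- N ≤ x: carry into the coarse quotient; then also the fine digit overflows,
    -- because the block of length m containing s ends at most at N.
    overflow : + N ℤ.≤ x → Result
    overflow N≤x = ℤ.1ℤ , carry-up (+-cancelʳ-≤ (+ m) (+ ρ ℤ.+ e) (+ N) m+N≤ρ+e+N) ,
                   quotient ℤ.1ℤ (x ℤ.- + N) (take-off x (+ N)) (ℤP.i≤j⇒0≤j-i N≤x) x-N<N
      where
      open ℤP.≤-Reasoning
      ρ : ℕ
      ρ = u %ℕ m
      take-off : ∀ x N → x ≡ x ℤ.- N ℤ.+ ℤ.1ℤ ℤ.* N
      take-off = solve-∀
      block-end-ℤ : + s ℤ.+ + m ℤ.≤ + ρ ℤ.+ + N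
      block-end-ℤ = subst₂ ℤ._≤_ (ℤP.pos-+ s m) (trans (ℤP.pos-+ _ N) (cong (λ r → + r ℤ.+ + N) (sym (fine-of-residue u))))
                     (ℤ.+≤+ (block-end (n%ℕd<d u N)))
      rearrange₁ : ∀ m s e → m ℤ.+ (s ℤ.+ e) ≡ s ℤ.+ m ℤ.+ e
      rearrange₁ = solve-∀
      rearrange₂ : ∀ ρ N e → ρ ℤ.+ N ℤ.+ e ≡ ρ ℤ.+ e ℤ.+ N
      rearrange₂ = solve-∀
      m+N≤ρ+e+N : + m ℤ.+ + N ℤ.≤ + ρ ℤ.+ e ℤ.+ + N
      m+N≤ρ+e+N = begin
        + m ℤ.+ + N             ≤⟨ ℤP.+-monoʳ-≤ (+ m) N≤x ⟩
        + m ℤ.+ x               ≡⟨ rearrange₁ (+ m) (+ s) e ⟩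
        + s ℤ.+ + m ℤ.+ e       ≤⟨ ℤP.+-monoˡ-≤ e block-end-ℤ ⟩
        + ρ ℤ.+ + N ℤ.+ e       ≡⟨ rearrange₂ (+ ρ) (+ N) e ⟩
        + ρ ℤ.+ e ℤ.+ + N       ∎
      cancel : ∀ N → N ℤ.+ N ℤ.- N ≡ N
      cancel = solve-∀
      x-N<N : x ℤ.- + N ℤ.< + N
      x-N<N = begin-strict
        x ℤ.- + N               <⟨ ℤP.+-monoˡ-< (ℤ.- + N) (ℤP.+-mono-<-≤ (ℤ.+<+ (n%ℕd<d u N)) (ℤP.≤-trans (proj₂ e-bounds) m≤N)) ⟩
        + N ℤ.+ + N ℤ.- + N     ≡⟨ cancel (+ N) ⟩
        + N                     ∎

    carry-lemma : Result
    carry-lemma with x ℤP.<? 0ℤ | x ℤP.<? + N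
    ... | yes x<0 | _       = underflow x<0
    ... | no x≮0  | yes x<N = in-range (ℤP.≮⇒≥ x≮0) x<N
    ... | no _    | no x≮N  = overflow (ℤP.≮⇒≥ x≮N)

-- The finite
-- verifications are such folds of decisions, checked by evaluation; a plain fold
-- evaluates much faster than the library's composite decision procedures.
all-below : ℕ → (ℕ → Bool) → Bool
all-below zero    f = true
all-below (suc n) f = f n ∧ all-below n f

all-below-sound : ∀ n f → all-below n f ≡ true → ∀ {i} → i ℕ.< n → f i ≡ true
all-below-sound (suc n) f fs {i} i<1+n with ℕP.m<1+n⇒m<n∨m≡n i<1+n
... | inj₁ i<n  = all-below-sound n f (∧-conicalʳ (f n) (all-below n f) fs) i<n
... | inj₂ refl = ∧-conicalˡ (f n) (all-below n f) fs

yes-sound : ∀ {A : Set} (a? : Dec A) → isYes a? ≡ true → A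
yes-sound a? a?≡yes = toWitness (Equivalence.from T-≡ a?≡yes)

span : ℕ → ℕ
span r = suc (r + r)

offset : ℕ → ℕ → ℤ
offset r i = ℤ.- + r ℤ.+ + i

interval-index : ∀ r a → ∣ a ∣ ≤ r → ∃ λ i → i ℕ.< span r × a ≡ offset r i
interval-index r (+ j) j≤r = r + j , ℕ.s≤s (ℕP.+-monoʳ-≤ r j≤r) , shift (+ r) (+ j)
  where
  shift : ∀ r j → j ≡ ℤ.- r ℤ.+ (r ℤ.+ j)
  shift = solve-∀
interval-index r -[1+ j ] j<r = r ℕ.∸ suc j , ℕ.s≤s (ℕP.≤-trans (ℕP.m∸n≤m r (suc j)) (ℕP.m≤m+n r r)) , (begin
    -[1+ j ]                          ≡⟨ shift (+ r) (+ suc j) ⟩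
    ℤ.- + r ℤ.+ (+ r ℤ.- + suc j)     ≡⟨ cong (λ k → ℤ.- + r ℤ.+ k) (trans (ℤP.m-n≡m⊖n r (suc j)) (ℤP.⊖-≥ j<r)) ⟩
    ℤ.- + r ℤ.+ + (r ℕ.∸ suc j)       ∎)
  where
  open ≡-Reasoning
  shift : ∀ r j → ℤ.- j ≡ ℤ.- r ℤ.+ (r ℤ.- j)
  shift = solve-∀

interval-∀ : ∀ {P : ℤ → Set} r → (∀ {i} → i ℕ.< span r → P (offset r i)) → ∀ a → ∣ a ∣ ≤ r → P a
interval-∀ {P} r instances a ∣a∣≤r with interval-index r a ∣a∣≤r
... | i , i<span , a≡offset = subst P (sym a≡offset) (instances i<span)

inner : ℕ → ℕ → ℕ
inner r i = r ℕ.∸ ∣ offset r i ∣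

ball-∀ : ∀ {P : ℤ → ℤ → Set} r →
         (∀ {i j} → i ℕ.< span r → j ℕ.< span (inner r i) → P (offset r i) (offset (inner r i) j)) →
         ∀ a b → ∣ a ∣ + ∣ b ∣ ≤ r → P a b
ball-∀ {P} r instances a b ab≤r =
  interval-∀ {λ a → ∀ b → ∣ b ∣ ≤ r ℕ.∸ ∣ a ∣ → P a b} r
    (λ i<span → interval-∀ {P _} (inner r _) (instances i<span))
    a (ℕP.m+n≤o⇒m≤o ∣ a ∣ ab≤r) b ∣b∣≤r-∣a∣
  where
  ∣b∣≤r-∣a∣ : ∣ b ∣ ≤ r ℕ.∸ ∣ a ∣
  ∣b∣≤r-∣a∣ = ℕP.≤-trans (ℕP.≤-reflexive (sym (ℕP.m+n∸m≡n ∣ a ∣ ∣ b ∣))) (ℕP.∸-monoˡ-≤ ∣ a ∣ ab≤r)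

∀-carry? : ∀ {P : ℤ → Set} m ρ e → Decidable P → Dec (∀ κ → Carry m ρ e κ → P κ)
∀-carry? {P} m ρ e P? =
  map′ every-carry from-every-carry
    (P? 0ℤ ×-dec ((+ m ℤP.≤? + ρ ℤ.+ e) →-dec P? ℤ.1ℤ) ×-dec ((+ ρ ℤ.+ e ℤP.<? 0ℤ) →-dec P? ℤ.-1ℤ))
  where
  Cases : Set
  Cases = P 0ℤ × (+ m ℤ.≤ + ρ ℤ.+ e → P ℤ.1ℤ) × (+ ρ ℤ.+ e ℤ.< 0ℤ → P ℤ.-1ℤ)
  every-carry : Cases → ∀ κ → Carry m ρ e κ → P κ
  every-carry (p₀ , p₊ , p₋) .0ℤ    no-carry          = p₀
  every-carry (p₀ , p₊ , p₋) .ℤ.1ℤ  (carry-up up)     = p₊ up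
  every-carry (p₀ , p₊ , p₋) .ℤ.-1ℤ (carry-down down) = p₋ down
  from-every-carry : (∀ κ → Carry m ρ e κ → P κ) → Cases
  from-every-carry all = all 0ℤ no-carry , (λ up → all ℤ.1ℤ (carry-up up)) , (λ down → all ℤ.-1ℤ (carry-down down))

-- Periodic colourings of the path G(ℤ,{1,1}) = G(ℤ,{1}) by a motif of length q.
module PeriodicPath {q k : ℕ} .{{_ : NonZero q}} (motif : Vec (Fin k) q) where

  colour : ℤ → Fin k
  colour u = lookup motif (u %ℕ q mod q)

  Safe : ℕ → ℤ → Set
  Safe ρ d = d ≢ 0ℤ → toℕ (lookup motif ((+ ρ ℤ.+ d) %ℕ q mod q)) ≢ toℕ (lookup motif (ρ mod q))

  safe? : ∀ ρ d → Dec (Safe ρ d)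
  safe? ρ d = ¬? (d ℤP.≟ 0ℤ) →-dec
              ¬? (toℕ (lookup motif ((+ ρ ℤ.+ d) %ℕ q mod q)) ℕP.≟ toℕ (lookup motif (ρ mod q)))

  radius : ℕ → ℕ
  radius ρ = suc (toℕ (lookup motif (ρ mod q)))

  residue-test : ℕ → Bool
  residue-test ρ = all-below (span (radius ρ)) λ i → isYes (safe? ρ (offset (radius ρ) i))

  verify : Bool
  verify = all-below q residue-test

  verified-safe : verify ≡ true → ∀ {ρ} → ρ ℕ.< q → ∀ d → ∣ d ∣ ≤ radius ρ → Safe ρ d
  verified-safe ok {ρ} ρ<q = interval-∀ {Safe ρ} (radius ρ) step-ok
    where
    step-ok : ∀ {i} → i ℕ.< span (radius ρ) → Safe ρ (offset (radius ρ) i)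
    step-ok {i} i<span = yes-sound (safe? ρ (offset (radius ρ) i))
      (all-below-sound (span (radius ρ)) (λ i → isYes (safe? ρ (offset (radius ρ) i)))
        (all-below-sound q residue-test ok ρ<q) i<span)

  path-packing : verify ≡ true → IsPackingColoring (1 ∷ 1 ∷ []) k colour
  path-packing ok = packing-criterion colour separated
    where
    open Walks 1 1
    separated : ∀ u a b → ∣ a ∣ + ∣ b ∣ ≤ suc (toℕ (colour u)) → displace u a b ≢ u →
                colour (displace u a b) ≢ colour u
    separated u a b ab≤c+1 v≢u same =
      verified-safe ok (n%ℕd<d u q) d (ℕP.≤-trans (ℤP.∣i+j∣≤∣i∣+∣j∣ a b) ab≤c+1) d≢0
        (trans (cong (λ ρ → toℕ (lookup motif (ρ mod q))) (sym (Division.%ℕ-+ q u d)))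
               (trans (cong (λ v → toℕ (lookup motif (v %ℕ q mod q))) (sym v≡u+d)) (cong toℕ same)))
      where
      d : ℤ
      d = a ℤ.+ b
      unit-steps : ∀ u a b → u ℤ.+ (a ℤ.* ℤ.1ℤ ℤ.+ b ℤ.* ℤ.1ℤ) ≡ u ℤ.+ (a ℤ.+ b)
      unit-steps = solve-∀
      v≡u+d : displace u a b ≡ u ℤ.+ d
      v≡u+d = unit-steps u a b
      d≢0 : d ≢ 0ℤ
      d≢0 d≡0 = v≢u (trans v≡u+d (trans (cong (λ x → u ℤ.+ x) d≡0) (ℤP.+-identityʳ u)))

module TableColouring {m p k : ℕ} .{{_ : NonZero m}} .{{_ : NonZero p}} (tab : Vec (Vec (Fin k) p) m) where

  cell : ℕ → ℕ → Fin k
  cell ρ Y = lookup (lookup tab (ρ mod m)) (Y mod p)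

  cell-after : ℕ → ℕ → ℤ → ℤ → Fin k
  cell-after ρ Y e β = cell ((+ ρ ℤ.+ e) %ℕ m) ((+ Y ℤ.+ β) %ℕ p)

  Safe : ℤ → ℕ → ℕ → ℤ → ℤ → Set
  Safe σ ρ Y a b = ¬ (a ≡ 0ℤ × b ≡ 0ℤ) →
    ∀ κ → Carry m ρ (a ℤ.+ σ ℤ.* b) κ → toℕ (cell-after ρ Y (a ℤ.+ σ ℤ.* b) (b ℤ.+ κ)) ≢ toℕ (cell ρ Y)

  safe? : ∀ σ ρ Y a b → Dec (Safe σ ρ Y a b)
  safe? σ ρ Y a b =
    ¬? ((a ℤP.≟ 0ℤ) ×-dec (b ℤP.≟ 0ℤ)) →-dec
    ∀-carry? m ρ (a ℤ.+ σ ℤ.* b) (λ κ → ¬? (toℕ (cell-after ρ Y (a ℤ.+ σ ℤ.* b) (b ℤ.+ κ)) ℕP.≟ toℕ (cell ρ Y)))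

  radius : ℕ → ℕ → ℕ
  radius ρ Y = suc (toℕ (cell ρ Y))

  step-test : ℤ → ℕ → ℕ → ℕ → ℕ → Bool
  step-test σ ρ Y i j = isYes (safe? σ ρ Y (offset (radius ρ Y) i) (offset (inner (radius ρ Y) i) j))

  cell-test : ℤ → ℕ → ℕ → Bool
  cell-test σ ρ Y = all-below (span (radius ρ Y)) λ i → all-below (span (inner (radius ρ Y) i)) (step-test σ ρ Y i)

  verify : ℤ → Bool
  verify σ = all-below m λ ρ → all-below p (cell-test σ ρ)

  verified-safe : ∀ {σ} → verify σ ≡ true → ∀ {ρ Y} → ρ ℕ.< m → Y ℕ.< p →
                  ∀ a b → ∣ a ∣ + ∣ b ∣ ≤ radius ρ Y → Safe σ ρ Y a b
  verified-safe {σ} ok {ρ} {Y} ρ<m Y<p =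
    ball-∀ {Safe σ ρ Y} (radius ρ Y)
      (λ {i} {j} i<span j<span → yes-sound (safe? σ ρ Y (offset (radius ρ Y) i) (offset (inner (radius ρ Y) i) j))
        (all-below-sound (span (inner (radius ρ Y) i)) (step-test σ ρ Y i) (row-ok i<span) j<span))
    where
    cell-ok : cell-test σ ρ Y ≡ true
    cell-ok = all-below-sound p (cell-test σ ρ) (all-below-sound m (λ ρ → all-below p (cell-test σ ρ)) ok ρ<m) Y<p
    row-ok : ∀ {i} → i ℕ.< span (radius ρ Y) → all-below (span (inner (radius ρ Y) i)) (step-test σ ρ Y i) ≡ true
    row-ok = all-below-sound (span (radius ρ Y)) (λ i → all-below (span (inner (radius ρ Y) i)) (step-test σ ρ Y i)) cell-ok

  module _ (n : ℕ) .{{_ : NonZero n}} where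
    open TwoScale m n
    open Division using (%ℕ-shift; /ℕ-shift; %ℕ-+)

    colour : ℤ → Fin k
    colour u = cell (u %ℕ m) ((u /ℕ N) %ℕ p)

    move : ∀ u e b → ∣ e ∣ ≤ m → ∃ λ κ → Carry m (u %ℕ m) e κ ×
           colour (u ℤ.+ e ℤ.+ b ℤ.* + N) ≡ cell-after (u %ℕ m) ((u /ℕ N) %ℕ p) e (b ℤ.+ κ)
    move u e b ∣e∣≤m with Adding.carry-lemma u e ∣e∣≤m
    ... | κ , carry , coarse-step = κ , carry , cong₂ cell row column
      where
      open ≡-Reasoning
      v : ℤ
      v = u ℤ.+ e ℤ.+ b ℤ.* + N
      reassoc : ∀ b n m → b ℤ.* (n ℤ.* m) ≡ (b ℤ.* n) ℤ.* m
      reassoc = solve-∀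
      row : v %ℕ m ≡ (+ (u %ℕ m) ℤ.+ e) %ℕ m
      row = begin
        v %ℕ m                                       ≡⟨ cong (λ z → (u ℤ.+ e ℤ.+ z) %ℕ m) (trans (cong (b ℤ.*_) (ℤP.pos-* n m)) (reassoc b (+ n) (+ m))) ⟩
        (u ℤ.+ e ℤ.+ (b ℤ.* + n) ℤ.* + m) %ℕ m       ≡⟨ %ℕ-shift m (u ℤ.+ e) (b ℤ.* + n) ⟩
        (u ℤ.+ e) %ℕ m                               ≡⟨ %ℕ-+ m u e ⟩
        (+ (u %ℕ m) ℤ.+ e) %ℕ m                      ∎
      swap : ∀ y κ b → y ℤ.+ κ ℤ.+ b ≡ y ℤ.+ (b ℤ.+ κ)
      swap = solve-∀
      column : (v /ℕ N) %ℕ p ≡ (+ ((u /ℕ N) %ℕ p) ℤ.+ (b ℤ.+ κ)) %ℕ p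
      column = begin
        (v /ℕ N) %ℕ p                                ≡⟨ cong (_%ℕ p) (/ℕ-shift N (u ℤ.+ e) b) ⟩
        ((u ℤ.+ e) /ℕ N ℤ.+ b) %ℕ p                  ≡⟨ cong (λ y → (y ℤ.+ b) %ℕ p) coarse-step ⟩
        (u /ℕ N ℤ.+ κ ℤ.+ b) %ℕ p                    ≡⟨ cong (_%ℕ p) (swap (u /ℕ N) κ b) ⟩
        (u /ℕ N ℤ.+ (b ℤ.+ κ)) %ℕ p                  ≡⟨ %ℕ-+ p (u /ℕ N) (b ℤ.+ κ) ⟩
        (+ ((u /ℕ N) %ℕ p) ℤ.+ (b ℤ.+ κ)) %ℕ p       ∎

    table-packing : ∀ {σ t} → k ≤ m → ∣ σ ∣ ≡ 1 → + t ≡ + N ℤ.+ σ → verify σ ≡ true →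
                    IsPackingColoring (1 ∷ t ∷ []) k colour
    table-packing {σ} {t} k≤m ∣σ∣≡1 t≡N+σ ok = packing-criterion colour separated
      where
      open Walks 1 t
      separated : ∀ u a b → ∣ a ∣ + ∣ b ∣ ≤ suc (toℕ (colour u)) → displace u a b ≢ u →
                  colour (displace u a b) ≢ colour u
      separated u a b ab≤c+1 v≢u same =
        let κ , carry , lands = move u e b ∣e∣≤m in
        verified-safe {σ} ok {u %ℕ m} {(u /ℕ N) %ℕ p} (n%ℕd<d u m) (n%ℕd<d (u /ℕ N) p) a b ab≤c+1 nonzero κ carry
          (cong toℕ (trans (sym lands) (trans (cong colour (sym v≡)) same)))
        where
        e : ℤ
        e = a ℤ.+ σ ℤ.* b
        ∣e∣≤m : ∣ e ∣ ≤ m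
        ∣e∣≤m = begin
          ∣ a ℤ.+ σ ℤ.* b ∣               ≤⟨ ℤP.∣i+j∣≤∣i∣+∣j∣ a (σ ℤ.* b) ⟩
          ∣ a ∣ + ∣ σ ℤ.* b ∣             ≡⟨ cong (λ z → ∣ a ∣ + z) (trans (ℤP.abs-* σ b) (trans (cong (_* ∣ b ∣) ∣σ∣≡1) (ℕP.*-identityˡ ∣ b ∣))) ⟩
          ∣ a ∣ + ∣ b ∣                   ≤⟨ ab≤c+1 ⟩
          suc (toℕ (colour u))            ≤⟨ FinP.toℕ<n (colour u) ⟩
          k                               ≤⟨ k≤m ⟩
          m                               ∎
          where open ℕP.≤-Reasoning
        regroup : ∀ u a b N σ → u ℤ.+ (a ℤ.* ℤ.1ℤ ℤ.+ b ℤ.* (N ℤ.+ σ)) ≡ u ℤ.+ (a ℤ.+ σ ℤ.* b) ℤ.+ b ℤ.* N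
        regroup = solve-∀
        v≡ : displace u a b ≡ u ℤ.+ e ℤ.+ b ℤ.* + N
        v≡ = trans (cong (λ z → u ℤ.+ (a ℤ.* ℤ.1ℤ ℤ.+ b ℤ.* z)) t≡N+σ) (regroup u a b (+ N) σ)
        nonzero : ¬ (a ≡ 0ℤ × b ≡ 0ℤ)
        nonzero (refl , refl) = v≢u (ℤP.+-identityʳ u)

-- The colouring of the path: 1, 2, 1, 3 repeated (entry i stands for colour i + 1).
path-motif : Vec (Fin 29) 4
path-motif = # 0 ∷ # 1 ∷ # 0 ∷ # 2 ∷ []

path-verified : PeriodicPath.verify path-motif ≡ true
path-verified = refl

-- Tables of colours for the case t = 96k ± 1; an entry i stands for colour i + 1.
-- Every even residue mod 96 receives colour 1.
colour-1 : Vec (Fin 29) 16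
colour-1 = replicate 16 (# 0)

table₊ : Vec (Vec (Fin 29) 16) 96
table₊ =
    colour-1 ∷
    (# 2 ∷ # 14 ∷ # 8 ∷ # 6 ∷ # 2 ∷ # 28 ∷ # 2 ∷ # 6 ∷ # 1 ∷ # 14 ∷ # 3 ∷ # 6 ∷ # 2 ∷ # 3 ∷ # 2 ∷ # 6 ∷ []) ∷
    colour-1 ∷
    (# 1 ∷ # 3 ∷ # 1 ∷ # 2 ∷ # 1 ∷ # 3 ∷ # 1 ∷ # 5 ∷ # 3 ∷ # 2 ∷ # 25 ∷ # 2 ∷ # 1 ∷ # 9 ∷ # 1 ∷ # 5 ∷ []) ∷
    colour-1 ∷
    (# 2 ∷ # 7 ∷ # 2 ∷ # 12 ∷ # 5 ∷ # 4 ∷ # 2 ∷ # 17 ∷ # 4 ∷ # 1 ∷ # 12 ∷ # 1 ∷ # 5 ∷ # 8 ∷ # 2 ∷ # 4 ∷ []) ∷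
    colour-1 ∷
    (# 1 ∷ # 13 ∷ # 1 ∷ # 4 ∷ # 1 ∷ # 2 ∷ # 1 ∷ # 7 ∷ # 1 ∷ # 2 ∷ # 20 ∷ # 2 ∷ # 4 ∷ # 2 ∷ # 1 ∷ # 3 ∷ []) ∷
    colour-1 ∷
    (# 2 ∷ # 6 ∷ # 2 ∷ # 3 ∷ # 2 ∷ # 6 ∷ # 3 ∷ # 9 ∷ # 2 ∷ # 3 ∷ # 13 ∷ # 1 ∷ # 6 ∷ # 1 ∷ # 7 ∷ # 18 ∷ []) ∷
    colour-1 ∷
    (# 1 ∷ # 11 ∷ # 1 ∷ # 5 ∷ # 1 ∷ # 10 ∷ # 1 ∷ # 2 ∷ # 1 ∷ # 4 ∷ # 1 ∷ # 2 ∷ # 10 ∷ # 2 ∷ # 3 ∷ # 2 ∷ []) ∷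
    colour-1 ∷
    (# 5 ∷ # 4 ∷ # 3 ∷ # 2 ∷ # 4 ∷ # 2 ∷ # 8 ∷ # 4 ∷ # 5 ∷ # 23 ∷ # 11 ∷ # 8 ∷ # 5 ∷ # 1 ∷ # 4 ∷ # 1 ∷ []) ∷
    colour-1 ∷
    (# 2 ∷ # 9 ∷ # 2 ∷ # 1 ∷ # 16 ∷ # 1 ∷ # 3 ∷ # 1 ∷ # 2 ∷ # 3 ∷ # 2 ∷ # 1 ∷ # 2 ∷ # 3 ∷ # 2 ∷ # 24 ∷ []) ∷
    colour-1 ∷
    (# 1 ∷ # 15 ∷ # 1 ∷ # 6 ∷ # 14 ∷ # 2 ∷ # 19 ∷ # 2 ∷ # 21 ∷ # 7 ∷ # 1 ∷ # 6 ∷ # 14 ∷ # 4 ∷ # 1 ∷ # 6 ∷ []) ∷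
    colour-1 ∷
    (# 2 ∷ # 4 ∷ # 2 ∷ # 3 ∷ # 2 ∷ # 4 ∷ # 12 ∷ # 1 ∷ # 4 ∷ # 1 ∷ # 2 ∷ # 4 ∷ # 2 ∷ # 12 ∷ # 2 ∷ # 7 ∷ []) ∷
    colour-1 ∷
    (# 1 ∷ # 3 ∷ # 1 ∷ # 5 ∷ # 1 ∷ # 7 ∷ # 1 ∷ # 5 ∷ # 2 ∷ # 6 ∷ # 3 ∷ # 5 ∷ # 1 ∷ # 3 ∷ # 1 ∷ # 5 ∷ []) ∷
    colour-1 ∷
    (# 4 ∷ # 2 ∷ # 10 ∷ # 2 ∷ # 8 ∷ # 2 ∷ # 22 ∷ # 2 ∷ # 3 ∷ # 13 ∷ # 1 ∷ # 2 ∷ # 10 ∷ # 2 ∷ # 8 ∷ # 2 ∷ []) ∷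
    colour-1 ∷
    (# 17 ∷ # 1 ∷ # 13 ∷ # 1 ∷ # 4 ∷ # 1 ∷ # 3 ∷ # 1 ∷ # 4 ∷ # 1 ∷ # 2 ∷ # 4 ∷ # 26 ∷ # 1 ∷ # 4 ∷ # 1 ∷ []) ∷
    colour-1 ∷
    (# 9 ∷ # 3 ∷ # 11 ∷ # 2 ∷ # 3 ∷ # 2 ∷ # 6 ∷ # 2 ∷ # 9 ∷ # 2 ∷ # 11 ∷ # 8 ∷ # 1 ∷ # 2 ∷ # 3 ∷ # 2 ∷ []) ∷
    colour-1 ∷
    (# 1 ∷ # 5 ∷ # 6 ∷ # 4 ∷ # 1 ∷ # 5 ∷ # 1 ∷ # 27 ∷ # 1 ∷ # 5 ∷ # 1 ∷ # 3 ∷ # 18 ∷ # 5 ∷ # 6 ∷ # 7 ∷ []) ∷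
    colour-1 ∷
    (# 2 ∷ # 4 ∷ # 2 ∷ # 1 ∷ # 2 ∷ # 7 ∷ # 2 ∷ # 4 ∷ # 2 ∷ # 3 ∷ # 2 ∷ # 4 ∷ # 2 ∷ # 20 ∷ # 2 ∷ # 1 ∷ []) ∷
    colour-1 ∷
    (# 28 ∷ # 3 ∷ # 1 ∷ # 8 ∷ # 3 ∷ # 14 ∷ # 1 ∷ # 3 ∷ # 1 ∷ # 16 ∷ # 1 ∷ # 7 ∷ # 1 ∷ # 14 ∷ # 1 ∷ # 4 ∷ []) ∷
    colour-1 ∷
    (# 2 ∷ # 1 ∷ # 2 ∷ # 10 ∷ # 2 ∷ # 1 ∷ # 2 ∷ # 12 ∷ # 2 ∷ # 8 ∷ # 2 ∷ # 10 ∷ # 2 ∷ # 6 ∷ # 2 ∷ # 3 ∷ []) ∷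
    colour-1 ∷
    (# 8 ∷ # 15 ∷ # 5 ∷ # 6 ∷ # 1 ∷ # 4 ∷ # 5 ∷ # 6 ∷ # 4 ∷ # 1 ∷ # 5 ∷ # 1 ∷ # 4 ∷ # 1 ∷ # 5 ∷ # 1 ∷ []) ∷
    colour-1 ∷
    (# 4 ∷ # 2 ∷ # 1 ∷ # 4 ∷ # 3 ∷ # 2 ∷ # 9 ∷ # 2 ∷ # 1 ∷ # 2 ∷ # 3 ∷ # 2 ∷ # 9 ∷ # 2 ∷ # 3 ∷ # 2 ∷ []) ∷
    colour-1 ∷
    (# 21 ∷ # 1 ∷ # 3 ∷ # 12 ∷ # 2 ∷ # 1 ∷ # 24 ∷ # 1 ∷ # 3 ∷ # 7 ∷ # 25 ∷ # 1 ∷ # 19 ∷ # 1 ∷ # 11 ∷ # 1 ∷ []) ∷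
    colour-1 ∷
    (# 7 ∷ # 2 ∷ # 6 ∷ # 2 ∷ # 1 ∷ # 7 ∷ # 11 ∷ # 2 ∷ # 4 ∷ # 2 ∷ # 1 ∷ # 2 ∷ # 4 ∷ # 2 ∷ # 6 ∷ # 2 ∷ []) ∷
    colour-1 ∷
    (# 3 ∷ # 1 ∷ # 4 ∷ # 1 ∷ # 5 ∷ # 4 ∷ # 2 ∷ # 1 ∷ # 5 ∷ # 1 ∷ # 8 ∷ # 6 ∷ # 13 ∷ # 17 ∷ # 1 ∷ # 8 ∷ []) ∷
    colour-1 ∷
    (# 22 ∷ # 5 ∷ # 10 ∷ # 2 ∷ # 3 ∷ # 13 ∷ # 1 ∷ # 3 ∷ # 10 ∷ # 2 ∷ # 3 ∷ # 2 ∷ # 1 ∷ # 5 ∷ # 3 ∷ # 2 ∷ []) ∷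
    colour-1 ∷
    (# 4 ∷ # 1 ∷ # 2 ∷ # 1 ∷ # 14 ∷ # 1 ∷ # 2 ∷ # 8 ∷ # 2 ∷ # 6 ∷ # 4 ∷ # 1 ∷ # 14 ∷ # 4 ∷ # 2 ∷ # 1 ∷ []) ∷
    colour-1 ∷
    (# 12 ∷ # 2 ∷ # 6 ∷ # 9 ∷ # 4 ∷ # 2 ∷ # 6 ∷ # 4 ∷ # 1 ∷ # 9 ∷ # 1 ∷ # 2 ∷ # 18 ∷ # 2 ∷ # 1 ∷ # 7 ∷ []) ∷
    colour-1 ∷
    (# 2 ∷ # 1 ∷ # 3 ∷ # 1 ∷ # 2 ∷ # 1 ∷ # 3 ∷ # 1 ∷ # 2 ∷ # 3 ∷ # 2 ∷ # 23 ∷ # 3 ∷ # 1 ∷ # 20 ∷ # 3 ∷ []) ∷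
    colour-1 ∷
    (# 1 ∷ # 5 ∷ # 15 ∷ # 4 ∷ # 8 ∷ # 5 ∷ # 7 ∷ # 2 ∷ # 16 ∷ # 5 ∷ # 1 ∷ # 12 ∷ # 1 ∷ # 5 ∷ # 4 ∷ # 2 ∷ []) ∷
    colour-1 ∷
    (# 6 ∷ # 26 ∷ # 2 ∷ # 1 ∷ # 2 ∷ # 1 ∷ # 2 ∷ # 1 ∷ # 4 ∷ # 1 ∷ # 2 ∷ # 4 ∷ # 2 ∷ # 7 ∷ # 2 ∷ # 1 ∷ []) ∷
    colour-1 ∷
    (# 8 ∷ # 2 ∷ # 1 ∷ # 11 ∷ # 3 ∷ # 6 ∷ # 27 ∷ # 3 ∷ # 10 ∷ # 2 ∷ # 3 ∷ # 8 ∷ # 1 ∷ # 6 ∷ # 1 ∷ # 10 ∷ []) ∷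
    colour-1 ∷
    (# 2 ∷ # 1 ∷ # 3 ∷ # 4 ∷ # 2 ∷ # 1 ∷ # 4 ∷ # 1 ∷ # 2 ∷ # 1 ∷ # 6 ∷ # 1 ∷ # 2 ∷ # 11 ∷ # 2 ∷ # 3 ∷ []) ∷
    colour-1 ∷
    (# 1 ∷ # 4 ∷ # 5 ∷ # 2 ∷ # 1 ∷ # 9 ∷ # 5 ∷ # 2 ∷ # 13 ∷ # 19 ∷ # 5 ∷ # 2 ∷ # 9 ∷ # 4 ∷ # 1 ∷ # 28 ∷ []) ∷
    colour-1 ∷
    (# 2 ∷ # 13 ∷ # 2 ∷ # 1 ∷ # 6 ∷ # 14 ∷ # 2 ∷ # 1 ∷ # 8 ∷ # 1 ∷ # 2 ∷ # 4 ∷ # 21 ∷ # 1 ∷ # 2 ∷ # 5 ∷ []) ∷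
    colour-1 ∷
    (# 1 ∷ # 3 ∷ # 1 ∷ # 24 ∷ # 3 ∷ # 2 ∷ # 1 ∷ # 3 ∷ # 4 ∷ # 2 ∷ # 3 ∷ # 7 ∷ # 1 ∷ # 2 ∷ # 3 ∷ # 17 ∷ []) ∷
    colour-1 ∷
    (# 2 ∷ # 7 ∷ # 2 ∷ # 4 ∷ # 2 ∷ # 1 ∷ # 4 ∷ # 7 ∷ # 2 ∷ # 1 ∷ # 6 ∷ # 1 ∷ # 2 ∷ # 25 ∷ # 6 ∷ # 1 ∷ []) ∷
    colour-1 ∷
    (# 4 ∷ # 8 ∷ # 22 ∷ # 6 ∷ # 1 ∷ # 10 ∷ # 8 ∷ # 2 ∷ # 1 ∷ # 12 ∷ # 5 ∷ # 2 ∷ # 10 ∷ # 4 ∷ # 1 ∷ # 2 ∷ []) ∷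
    colour-1 ∷
    (# 3 ∷ # 1 ∷ # 12 ∷ # 1 ∷ # 2 ∷ # 3 ∷ # 2 ∷ # 1 ∷ # 6 ∷ # 3 ∷ # 2 ∷ # 1 ∷ # 3 ∷ # 1 ∷ # 2 ∷ # 5 ∷ []) ∷
    colour-1 ∷
    (# 1 ∷ # 2 ∷ # 14 ∷ # 2 ∷ # 5 ∷ # 9 ∷ # 1 ∷ # 11 ∷ # 5 ∷ # 2 ∷ # 1 ∷ # 9 ∷ # 4 ∷ # 2 ∷ # 8 ∷ # 16 ∷ []) ∷
    colour-1 ∷
    (# 2 ∷ # 4 ∷ # 6 ∷ # 1 ∷ # 4 ∷ # 1 ∷ # 2 ∷ # 4 ∷ # 2 ∷ # 1 ∷ # 4 ∷ # 15 ∷ # 2 ∷ # 1 ∷ # 6 ∷ # 1 ∷ []) ∷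
    colour-1 ∷
    (# 3 ∷ # 11 ∷ # 1 ∷ # 3 ∷ # 7 ∷ # 2 ∷ # 3 ∷ # 6 ∷ # 1 ∷ # 3 ∷ # 7 ∷ # 2 ∷ # 1 ∷ # 3 ∷ # 5 ∷ # 2 ∷ []) ∷
    colour-1 ∷
    (# 7 ∷ # 1 ∷ # 2 ∷ # 5 ∷ # 2 ∷ # 1 ∷ # 8 ∷ # 1 ∷ # 2 ∷ # 20 ∷ # 2 ∷ # 8 ∷ # 6 ∷ # 14 ∷ # 2 ∷ # 1 ∷ []) ∷
    colour-1 ∷
    (# 10 ∷ # 2 ∷ # 4 ∷ # 23 ∷ # 1 ∷ # 4 ∷ # 10 ∷ # 2 ∷ # 4 ∷ # 5 ∷ # 1 ∷ # 4 ∷ # 1 ∷ # 2 ∷ # 1 ∷ # 4 ∷ []) ∷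
    colour-1 ∷
    (# 2 ∷ # 1 ∷ # 3 ∷ # 1 ∷ # 2 ∷ # 3 ∷ # 2 ∷ # 1 ∷ # 3 ∷ # 18 ∷ # 2 ∷ # 3 ∷ # 2 ∷ # 19 ∷ # 3 ∷ # 26 ∷ []) ∷
    colour-1 ∷
    (# 1 ∷ # 5 ∷ # 12 ∷ # 2 ∷ # 6 ∷ # 13 ∷ # 1 ∷ # 9 ∷ # 6 ∷ # 2 ∷ # 1 ∷ # 12 ∷ # 1 ∷ # 13 ∷ # 1 ∷ # 2 ∷ []) ∷
    colour-1 ∷
    (# 4 ∷ # 6 ∷ # 2 ∷ # 1 ∷ # 4 ∷ # 1 ∷ # 2 ∷ # 4 ∷ # 2 ∷ # 1 ∷ # 4 ∷ # 7 ∷ # 2 ∷ # 4 ∷ # 2 ∷ # 21 ∷ []) ∷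
    colour-1 ∷
    (# 1 ∷ # 7 ∷ # 1 ∷ # 3 ∷ # 8 ∷ # 2 ∷ # 3 ∷ # 5 ∷ # 1 ∷ # 8 ∷ # 3 ∷ # 5 ∷ # 1 ∷ # 3 ∷ # 1 ∷ # 5 ∷ []) ∷
    colour-1 ∷
    (# 2 ∷ # 3 ∷ # 2 ∷ # 9 ∷ # 2 ∷ # 1 ∷ # 11 ∷ # 1 ∷ # 2 ∷ # 16 ∷ # 2 ∷ # 1 ∷ # 2 ∷ # 27 ∷ # 2 ∷ # 11 ∷ []) ∷
    colour-1 ∷
    (# 1 ∷ # 15 ∷ # 1 ∷ # 4 ∷ # 1 ∷ # 10 ∷ # 4 ∷ # 2 ∷ # 7 ∷ # 4 ∷ # 1 ∷ # 22 ∷ # 4 ∷ # 10 ∷ # 1 ∷ # 4 ∷ []) ∷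
    []

table₋ : Vec (Vec (Fin 29) 16) 96
table₋ =
    colour-1 ∷
    (# 2 ∷ # 1 ∷ # 4 ∷ # 1 ∷ # 14 ∷ # 4 ∷ # 2 ∷ # 26 ∷ # 2 ∷ # 6 ∷ # 2 ∷ # 15 ∷ # 2 ∷ # 3 ∷ # 2 ∷ # 4 ∷ []) ∷
    colour-1 ∷
    (# 6 ∷ # 2 ∷ # 3 ∷ # 2 ∷ # 6 ∷ # 16 ∷ # 1 ∷ # 9 ∷ # 1 ∷ # 3 ∷ # 1 ∷ # 14 ∷ # 1 ∷ # 9 ∷ # 1 ∷ # 3 ∷ []) ∷
    colour-1 ∷
    (# 24 ∷ # 1 ∷ # 7 ∷ # 1 ∷ # 3 ∷ # 2 ∷ # 4 ∷ # 2 ∷ # 7 ∷ # 4 ∷ # 2 ∷ # 6 ∷ # 2 ∷ # 7 ∷ # 2 ∷ # 1 ∷ []) ∷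
    colour-1 ∷
    (# 12 ∷ # 2 ∷ # 4 ∷ # 8 ∷ # 1 ∷ # 5 ∷ # 1 ∷ # 11 ∷ # 1 ∷ # 5 ∷ # 1 ∷ # 4 ∷ # 1 ∷ # 5 ∷ # 13 ∷ # 2 ∷ []) ∷
    colour-1 ∷
    (# 5 ∷ # 1 ∷ # 2 ∷ # 10 ∷ # 2 ∷ # 13 ∷ # 2 ∷ # 8 ∷ # 2 ∷ # 3 ∷ # 2 ∷ # 19 ∷ # 2 ∷ # 1 ∷ # 4 ∷ # 1 ∷ []) ∷
    colour-1 ∷
    (# 6 ∷ # 3 ∷ # 1 ∷ # 4 ∷ # 1 ∷ # 3 ∷ # 1 ∷ # 28 ∷ # 1 ∷ # 10 ∷ # 1 ∷ # 3 ∷ # 6 ∷ # 2 ∷ # 3 ∷ # 2 ∷ []) ∷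
    colour-1 ∷
    (# 2 ∷ # 18 ∷ # 2 ∷ # 6 ∷ # 2 ∷ # 4 ∷ # 2 ∷ # 6 ∷ # 2 ∷ # 4 ∷ # 2 ∷ # 8 ∷ # 1 ∷ # 11 ∷ # 1 ∷ # 4 ∷ []) ∷
    colour-1 ∷
    (# 9 ∷ # 1 ∷ # 7 ∷ # 1 ∷ # 12 ∷ # 1 ∷ # 3 ∷ # 1 ∷ # 9 ∷ # 1 ∷ # 22 ∷ # 2 ∷ # 7 ∷ # 2 ∷ # 23 ∷ # 1 ∷ []) ∷
    colour-1 ∷
    (# 4 ∷ # 2 ∷ # 3 ∷ # 2 ∷ # 5 ∷ # 2 ∷ # 7 ∷ # 2 ∷ # 3 ∷ # 5 ∷ # 1 ∷ # 3 ∷ # 1 ∷ # 5 ∷ # 3 ∷ # 2 ∷ []) ∷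
    colour-1 ∷
    (# 8 ∷ # 1 ∷ # 4 ∷ # 1 ∷ # 17 ∷ # 1 ∷ # 4 ∷ # 1 ∷ # 2 ∷ # 4 ∷ # 2 ∷ # 6 ∷ # 4 ∷ # 1 ∷ # 25 ∷ # 1 ∷ []) ∷
    colour-1 ∷
    (# 15 ∷ # 2 ∷ # 6 ∷ # 2 ∷ # 20 ∷ # 2 ∷ # 6 ∷ # 14 ∷ # 1 ∷ # 12 ∷ # 1 ∷ # 2 ∷ # 10 ∷ # 2 ∷ # 6 ∷ # 2 ∷ []) ∷
    colour-1 ∷
    (# 3 ∷ # 1 ∷ # 10 ∷ # 1 ∷ # 3 ∷ # 1 ∷ # 2 ∷ # 3 ∷ # 2 ∷ # 8 ∷ # 3 ∷ # 1 ∷ # 21 ∷ # 1 ∷ # 14 ∷ # 1 ∷ []) ∷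
    colour-1 ∷
    (# 2 ∷ # 5 ∷ # 2 ∷ # 8 ∷ # 4 ∷ # 5 ∷ # 16 ∷ # 1 ∷ # 4 ∷ # 5 ∷ # 2 ∷ # 4 ∷ # 2 ∷ # 5 ∷ # 2 ∷ # 4 ∷ []) ∷
    colour-1 ∷
    (# 9 ∷ # 11 ∷ # 1 ∷ # 2 ∷ # 1 ∷ # 2 ∷ # 9 ∷ # 2 ∷ # 1 ∷ # 7 ∷ # 1 ∷ # 3 ∷ # 1 ∷ # 13 ∷ # 1 ∷ # 7 ∷ []) ∷
    colour-1 ∷
    (# 2 ∷ # 3 ∷ # 6 ∷ # 7 ∷ # 3 ∷ # 1 ∷ # 6 ∷ # 3 ∷ # 2 ∷ # 11 ∷ # 2 ∷ # 8 ∷ # 2 ∷ # 3 ∷ # 2 ∷ # 1 ∷ []) ∷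
    colour-1 ∷
    (# 1 ∷ # 4 ∷ # 1 ∷ # 2 ∷ # 4 ∷ # 2 ∷ # 1 ∷ # 4 ∷ # 1 ∷ # 6 ∷ # 1 ∷ # 4 ∷ # 1 ∷ # 6 ∷ # 4 ∷ # 19 ∷ []) ∷
    colour-1 ∷
    (# 2 ∷ # 5 ∷ # 13 ∷ # 10 ∷ # 8 ∷ # 5 ∷ # 2 ∷ # 18 ∷ # 2 ∷ # 5 ∷ # 2 ∷ # 24 ∷ # 2 ∷ # 1 ∷ # 2 ∷ # 27 ∷ []) ∷
    colour-1 ∷
    (# 3 ∷ # 1 ∷ # 2 ∷ # 1 ∷ # 12 ∷ # 1 ∷ # 3 ∷ # 1 ∷ # 10 ∷ # 1 ∷ # 3 ∷ # 12 ∷ # 5 ∷ # 3 ∷ # 8 ∷ # 1 ∷ []) ∷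
    colour-1 ∷
    (# 6 ∷ # 4 ∷ # 3 ∷ # 2 ∷ # 4 ∷ # 2 ∷ # 7 ∷ # 2 ∷ # 4 ∷ # 2 ∷ # 1 ∷ # 4 ∷ # 1 ∷ # 2 ∷ # 4 ∷ # 2 ∷ []) ∷
    colour-1 ∷
    (# 7 ∷ # 1 ∷ # 9 ∷ # 1 ∷ # 6 ∷ # 1 ∷ # 14 ∷ # 8 ∷ # 6 ∷ # 22 ∷ # 2 ∷ # 7 ∷ # 9 ∷ # 1 ∷ # 14 ∷ # 1 ∷ []) ∷
    colour-1 ∷
    (# 26 ∷ # 2 ∷ # 5 ∷ # 2 ∷ # 3 ∷ # 2 ∷ # 1 ∷ # 2 ∷ # 1 ∷ # 3 ∷ # 1 ∷ # 2 ∷ # 3 ∷ # 2 ∷ # 5 ∷ # 2 ∷ []) ∷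
    colour-1 ∷
    (# 8 ∷ # 1 ∷ # 15 ∷ # 1 ∷ # 4 ∷ # 5 ∷ # 11 ∷ # 4 ∷ # 2 ∷ # 5 ∷ # 4 ∷ # 1 ∷ # 16 ∷ # 1 ∷ # 11 ∷ # 1 ∷ []) ∷
    colour-1 ∷
    (# 4 ∷ # 2 ∷ # 20 ∷ # 2 ∷ # 1 ∷ # 2 ∷ # 1 ∷ # 28 ∷ # 1 ∷ # 2 ∷ # 8 ∷ # 2 ∷ # 10 ∷ # 2 ∷ # 3 ∷ # 2 ∷ []) ∷
    colour-1 ∷
    (# 3 ∷ # 1 ∷ # 7 ∷ # 3 ∷ # 6 ∷ # 21 ∷ # 2 ∷ # 3 ∷ # 6 ∷ # 1 ∷ # 3 ∷ # 1 ∷ # 4 ∷ # 1 ∷ # 6 ∷ # 1 ∷ []) ∷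
    colour-1 ∷
    (# 13 ∷ # 2 ∷ # 1 ∷ # 8 ∷ # 1 ∷ # 4 ∷ # 1 ∷ # 2 ∷ # 13 ∷ # 2 ∷ # 5 ∷ # 2 ∷ # 7 ∷ # 2 ∷ # 5 ∷ # 2 ∷ []) ∷
    colour-1 ∷
    (# 4 ∷ # 5 ∷ # 2 ∷ # 10 ∷ # 2 ∷ # 5 ∷ # 7 ∷ # 4 ∷ # 1 ∷ # 9 ∷ # 1 ∷ # 3 ∷ # 1 ∷ # 4 ∷ # 1 ∷ # 9 ∷ []) ∷
    colour-1 ∷
    (# 3 ∷ # 1 ∷ # 12 ∷ # 1 ∷ # 3 ∷ # 1 ∷ # 2 ∷ # 3 ∷ # 2 ∷ # 4 ∷ # 2 ∷ # 12 ∷ # 2 ∷ # 3 ∷ # 2 ∷ # 1 ∷ []) ∷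
    colour-1 ∷
    (# 6 ∷ # 2 ∷ # 25 ∷ # 2 ∷ # 6 ∷ # 8 ∷ # 23 ∷ # 1 ∷ # 6 ∷ # 1 ∷ # 8 ∷ # 1 ∷ # 6 ∷ # 19 ∷ # 17 ∷ # 2 ∷ []) ∷
    colour-1 ∷
    (# 1 ∷ # 14 ∷ # 1 ∷ # 4 ∷ # 1 ∷ # 2 ∷ # 11 ∷ # 2 ∷ # 10 ∷ # 2 ∷ # 4 ∷ # 2 ∷ # 1 ∷ # 4 ∷ # 1 ∷ # 11 ∷ []) ∷
    colour-1 ∷
    (# 2 ∷ # 3 ∷ # 2 ∷ # 24 ∷ # 3 ∷ # 1 ∷ # 4 ∷ # 3 ∷ # 14 ∷ # 1 ∷ # 5 ∷ # 3 ∷ # 2 ∷ # 8 ∷ # 2 ∷ # 4 ∷ []) ∷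
    colour-1 ∷
    (# 1 ∷ # 5 ∷ # 1 ∷ # 2 ∷ # 7 ∷ # 5 ∷ # 1 ∷ # 2 ∷ # 15 ∷ # 2 ∷ # 7 ∷ # 16 ∷ # 1 ∷ # 3 ∷ # 1 ∷ # 7 ∷ []) ∷
    colour-1 ∷
    (# 2 ∷ # 4 ∷ # 6 ∷ # 1 ∷ # 2 ∷ # 9 ∷ # 6 ∷ # 1 ∷ # 22 ∷ # 1 ∷ # 6 ∷ # 2 ∷ # 9 ∷ # 2 ∷ # 6 ∷ # 27 ∷ []) ∷
    colour-1 ∷
    (# 1 ∷ # 2 ∷ # 3 ∷ # 4 ∷ # 1 ∷ # 2 ∷ # 4 ∷ # 2 ∷ # 3 ∷ # 4 ∷ # 1 ∷ # 5 ∷ # 1 ∷ # 4 ∷ # 1 ∷ # 3 ∷ []) ∷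
    colour-1 ∷
    (# 8 ∷ # 1 ∷ # 2 ∷ # 12 ∷ # 3 ∷ # 1 ∷ # 5 ∷ # 1 ∷ # 2 ∷ # 10 ∷ # 2 ∷ # 3 ∷ # 12 ∷ # 18 ∷ # 2 ∷ # 13 ∷ []) ∷
    colour-1 ∷
    (# 10 ∷ # 5 ∷ # 1 ∷ # 2 ∷ # 8 ∷ # 2 ∷ # 13 ∷ # 20 ∷ # 1 ∷ # 8 ∷ # 26 ∷ # 2 ∷ # 1 ∷ # 5 ∷ # 1 ∷ # 2 ∷ []) ∷
    colour-1 ∷
    (# 2 ∷ # 4 ∷ # 11 ∷ # 1 ∷ # 4 ∷ # 1 ∷ # 2 ∷ # 21 ∷ # 4 ∷ # 1 ∷ # 6 ∷ # 4 ∷ # 2 ∷ # 7 ∷ # 4 ∷ # 1 ∷ []) ∷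
    colour-1 ∷
    (# 1 ∷ # 2 ∷ # 3 ∷ # 2 ∷ # 6 ∷ # 3 ∷ # 1 ∷ # 2 ∷ # 3 ∷ # 2 ∷ # 1 ∷ # 3 ∷ # 1 ∷ # 2 ∷ # 3 ∷ # 6 ∷ []) ∷
    colour-1 ∷
    (# 7 ∷ # 1 ∷ # 5 ∷ # 1 ∷ # 2 ∷ # 7 ∷ # 5 ∷ # 1 ∷ # 9 ∷ # 11 ∷ # 2 ∷ # 14 ∷ # 17 ∷ # 1 ∷ # 2 ∷ # 9 ∷ []) ∷
    colour-1 ∷
    (# 4 ∷ # 2 ∷ # 14 ∷ # 4 ∷ # 1 ∷ # 2 ∷ # 4 ∷ # 2 ∷ # 1 ∷ # 4 ∷ # 1 ∷ # 2 ∷ # 4 ∷ # 28 ∷ # 1 ∷ # 2 ∷ []) ∷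
    colour-1 ∷
    (# 3 ∷ # 1 ∷ # 2 ∷ # 3 ∷ # 16 ∷ # 1 ∷ # 3 ∷ # 6 ∷ # 2 ∷ # 3 ∷ # 5 ∷ # 1 ∷ # 2 ∷ # 3 ∷ # 15 ∷ # 1 ∷ []) ∷
    colour-1 ∷
    (# 8 ∷ # 12 ∷ # 6 ∷ # 2 ∷ # 19 ∷ # 2 ∷ # 1 ∷ # 7 ∷ # 1 ∷ # 2 ∷ # 6 ∷ # 10 ∷ # 1 ∷ # 2 ∷ # 6 ∷ # 2 ∷ []) ∷
    colour-1 ∷
    (# 5 ∷ # 1 ∷ # 10 ∷ # 1 ∷ # 8 ∷ # 4 ∷ # 2 ∷ # 13 ∷ # 4 ∷ # 8 ∷ # 2 ∷ # 4 ∷ # 5 ∷ # 1 ∷ # 4 ∷ # 1 ∷ []) ∷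
    colour-1 ∷
    (# 23 ∷ # 2 ∷ # 3 ∷ # 2 ∷ # 1 ∷ # 3 ∷ # 1 ∷ # 2 ∷ # 1 ∷ # 3 ∷ # 1 ∷ # 2 ∷ # 3 ∷ # 2 ∷ # 13 ∷ # 2 ∷ []) ∷
    colour-1 ∷
    (# 4 ∷ # 1 ∷ # 5 ∷ # 6 ∷ # 22 ∷ # 9 ∷ # 5 ∷ # 12 ∷ # 2 ∷ # 7 ∷ # 25 ∷ # 1 ∷ # 9 ∷ # 1 ∷ # 3 ∷ # 1 ∷ []) ∷
    colour-1 ∷
    (# 2 ∷ # 18 ∷ # 2 ∷ # 1 ∷ # 2 ∷ # 1 ∷ # 6 ∷ # 1 ∷ # 11 ∷ # 2 ∷ # 6 ∷ # 2 ∷ # 4 ∷ # 2 ∷ # 6 ∷ # 11 ∷ []) ∷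
    colour-1 ∷
    (# 1 ∷ # 4 ∷ # 7 ∷ # 3 ∷ # 4 ∷ # 2 ∷ # 3 ∷ # 4 ∷ # 1 ∷ # 3 ∷ # 1 ∷ # 5 ∷ # 1 ∷ # 7 ∷ # 1 ∷ # 3 ∷ []) ∷
    colour-1 ∷
    (# 2 ∷ # 1 ∷ # 2 ∷ # 1 ∷ # 8 ∷ # 1 ∷ # 2 ∷ # 10 ∷ # 2 ∷ # 8 ∷ # 2 ∷ # 3 ∷ # 2 ∷ # 4 ∷ # 2 ∷ # 8 ∷ []) ∷
    colour-1 ∷
    (# 17 ∷ # 5 ∷ # 27 ∷ # 2 ∷ # 20 ∷ # 5 ∷ # 1 ∷ # 21 ∷ # 1 ∷ # 4 ∷ # 1 ∷ # 12 ∷ # 1 ∷ # 5 ∷ # 1 ∷ # 10 ∷ []) ∷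
    []

table₊-verified : TableColouring.verify table₊ ℤ.1ℤ ≡ true
table₊-verified = refl

table₋-verified : TableColouring.verify table₋ ℤ.-1ℤ ≡ true
table₋-verified = refl

plus-one : ∀ k → + (96 * k + 1) ≡ + (k * 96) ℤ.+ ℤ.1ℤ
plus-one k = trans (ℤP.pos-+ (96 * k) 1) (cong (λ N → + N ℤ.+ ℤ.1ℤ) (ℕP.*-comm 96 k))

minus-one : ∀ {t} k → t + 1 ≡ 96 * k → + t ≡ + (k * 96) ℤ.+ ℤ.-1ℤ
minus-one {t} k t+1≡96k = begin
    + t                          ≡⟨ add-subtract (+ t) ⟩
    + t ℤ.+ ℤ.1ℤ ℤ.+ ℤ.-1ℤ       ≡⟨ cong (ℤ._+ ℤ.-1ℤ) (ℤP.pos-+ t 1) ⟨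
    + (t + 1) ℤ.+ ℤ.-1ℤ          ≡⟨ cong (λ N → + N ℤ.+ ℤ.-1ℤ) (trans t+1≡96k (ℕP.*-comm 96 k)) ⟩
    + (k * 96) ℤ.+ ℤ.-1ℤ         ∎
  where
  open ≡-Reasoning
  add-subtract : ∀ x → x ≡ x ℤ.+ ℤ.1ℤ ℤ.+ ℤ.-1ℤ
  add-subtract = solve-∀

-- At most 29 colours are used, fewer than the 96 rows of the tables, so the
-- row shift e = a ± b of a step within colour range is covered by the carry lemma.
29≤96 : 29 ≤ 96
29≤96 = ℕP.m≤m+n 29 67

proposition5 : (t : ℕ) → 1 ≤ t →
    ((∃ λ q → t + 1 ≡ 96 * q) ⊎ (∃ λ q → t ≡ 96 * q + 1)) →
    PackingChromatic≤ (1 ∷ t ∷ []) 29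
proposition5 t _ (inj₂ (zero , refl)) =
  PeriodicPath.colour path-motif , PeriodicPath.path-packing path-motif path-verified
proposition5 t _ (inj₂ (suc k , refl)) =
  TableColouring.colour table₊ (suc k) ,
  TableColouring.table-packing table₊ (suc k) {ℤ.1ℤ} 29≤96 refl (plus-one (suc k)) table₊-verified
proposition5 t _ (inj₁ (zero , t+1≡0)) = contradiction (trans (ℕP.+-comm 1 t) t+1≡0) λ ()
proposition5 t _ (inj₁ (suc k , t+1≡96k)) =
  TableColouring.colour table₋ (suc k) ,
  TableColouring.table-packing table₋ (suc k) {ℤ.-1ℤ} 29≤96 refl (minus-one (suc k) t+1≡96k) table₋-verified
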